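{- (Purity Lemma) Let $p$ be a prime, $r\ge1$ an integer, $f\in\mathbb{Q}[x]$ a $p^r$-pure polynomial of degree $d>1$, and $g(x)=bx^t\in\mathbb{Q}[x]$ a monomial with $t\ge1$ and $b\neq0$. Then: (i) If $\nu_p(b)=0$, then $f\circ g$ is $p^r$-pure, and there exists $c\in\mathbb{Q}$ such that $g\circ f+c$ is $p^r$-pure. (ii) If $\frac{\nu_p(b)}{e-t}\ge\frac{r}{e}$ for some integer $e>t$, then there exists $c\in\mathbb{Q}$ such that $x^{de}+g\circ f+c$ is $p^r$-pure.
   Context: $\nu_p$ denotes the $p$-adic valuation on $\mathbb{Q}$ (with $\nu_p(0)=\infty$). A polynomial $q(x)=a_nx^n+\dots+a_0\in\mathbb{Q}[x]$ of degree $n$ is $p^r$-pure if $\nu_p(a_n)=0$, $\nu_p(a_0)=r$, and $\frac{\nu_p(a_i)}{n-i}\ge\frac{r}{n}$ for all $1\le i\le n-1$. -}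

module Defs where

open import Data.Nat as ℕ using (ℕ; zero; suc)
open import Data.Nat.Divisibility using (_∣?_)
open import Data.Nat.DivMod using (_/_)
open import Data.Integer as ℤ using (ℤ; +_; ∣_∣)
open import Data.Rational as ℚ using (ℚ; ↥_; ↧ₙ_; 0ℚ; 1ℚ)
open import Data.List using (List; []; _∷_; replicate; _++_)
open import Data.Sum using (_⊎_)
open import Data.Product using (Σ; _×_; ∃)
open import Relation.Nullary using (¬_; yes; no)
open import Relation.Binary.PropositionalEquality using (_≡_)

-- number of factors (2+q) in n, with fuel
νgo : ℕ → ℕ → ℕ → ℕ
νgo zero    q n = 0
νgo (suc k) q n with suc (suc q) ∣? n
... | yes _ = suc (νgo k q (n / suc (suc q)))
... | no  _ = 0

-- ν_p on positive naturals (value at 0, and for p < 2, is meaningless)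
νℕ : ℕ → ℕ → ℕ
νℕ zero          n = 0
νℕ (suc zero)    n = 0
νℕ (suc (suc q)) n = νgo n q n

-- ν_p on ℚ (for a ≠ 0; a = num/den in lowest terms). The value at 0 is
-- a junk value; every use below requires the argument to be nonzero.
ν : ℕ → ℚ → ℤ
ν p a = + νℕ p ∣ ↥ a ∣ ℤ.- + νℕ p (↧ₙ a)

-- Polynomials in ℚ[x] as coefficient lists, constant term first.

Poly : Set
Poly = List ℚ

coeff : Poly → ℕ → ℚ
coeff []       _       = 0ℚ
coeff (a ∷ as) zero    = a
coeff (a ∷ as) (suc i) = coeff as i

_⊕_ : Poly → Poly → Poly
[]       ⊕ q        = q
(a ∷ as) ⊕ []       = a ∷ as
(a ∷ as) ⊕ (b ∷ bs) = (a ℚ.+ b) ∷ (as ⊕ bs)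

scale : ℚ → Poly → Poly
scale c []       = []
scale c (a ∷ as) = (c ℚ.* a) ∷ scale c as

_⊗_ : Poly → Poly → Poly
[]       ⊗ q = []
(a ∷ as) ⊗ q = scale a q ⊕ (0ℚ ∷ (as ⊗ q))

-- composition: (f ∘ₚ g)(x) = f(g(x)), by Horner's scheme
_∘ₚ_ : Poly → Poly → Poly
[]       ∘ₚ g = []
(a ∷ as) ∘ₚ g = (a ∷ []) ⊕ (g ⊗ (as ∘ₚ g))

monomial : ℚ → ℕ → Poly
monomial b t = replicate t 0ℚ ++ (b ∷ [])

const : ℚ → Poly
const c = c ∷ []

HasDegree : Poly → ℕ → Set
HasDegree q n = ¬ (coeff q n ≡ 0ℚ) × (∀ m → n ℕ.< m → coeff q m ≡ 0ℚ)

-- q of degree n is p^r-pure: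
--   ν_p(a_n) = 0, ν_p(a_0) = r (so a_0 ≠ 0), and for 1 ≤ i ≤ n-1,
--   ν_p(a_i)/(n-i) ≥ r/n, written with positive denominators cleared:
--   n·ν_p(a_i) ≥ r·(n-i); if a_i = 0 then ν_p(a_i) = ∞ and it holds.
PurePow : ℕ → ℕ → Poly → Set
PurePow p r q = Σ ℕ λ n →
  HasDegree q n ×
  ν p (coeff q n) ≡ + 0 ×
  ¬ (coeff q 0 ≡ 0ℚ) × ν p (coeff q 0) ≡ + r ×
  (∀ i → 1 ℕ.≤ i → i ℕ.< n →
     coeff q i ≡ 0ℚ ⊎ (+ r ℤ.* + (n ℕ.∸ i)) ℤ.≤ (+ n ℤ.* ν p (coeff q i)))

module Submission where

-- Write the coefficient condition of a p^r-pure polynomial of degree n as n·ν(aᵢ) ≥ r(n − i): all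
-- coefficients lie on or above the segment from (0, r) to (n, 0). Lower bounds of this kind are
-- additive under products (ν(ab) = ν(a) + ν(b), ν(a + b) ≥ min), so they propagate through the
-- coefficients of f(b xᵗ) and of b fᵗ. In (i), f(b xᵗ) has the coefficient aᵢbⁱ at x^{ti}, so the
-- segment is only stretched by t, while b fᵗ inherits the weight r(dt − i) at xⁱ and its constant
-- term is replaced by p^r through c. In (ii) the bound on ν(b) adds the weight r(e − t)d, which
-- together with r(dt − i)e dominates r(de − i) below x^{dt}; the leading coefficient is that of x^{de}.

open import Defs
open import Data.Nat as ℕ using (ℕ; zero; suc; _+_; _*_; _∸_; _^_; _≤_; _<_; z≤n; s≤s)
open import Data.Nat.Properties
open import Data.Nat.Divisibility using (_∣_; divides; _∣?_; ∣-refl; ∣-trans; m∣m*n; ∣1⇒≡1; ∣m∸n∣n⇒∣m)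
open import Data.Nat.DivMod using (_/_; m*n/n≡m)
open import Data.Nat.Induction using (<-rec)
open import Data.Nat.Primality using (Prime; euclidsLemma; prime⇒nonTrivial)
open import Data.Nat.Coprimality using (Coprime; 1-coprimeTo)
import Data.Nat.Coprimality as Coprimality
open import Data.Integer as ℤ using (ℤ; +_; -[1+_]; ∣_∣; +≤+)
import Data.Nat.Solver as ℕSolver
import Data.Integer.Properties as ℤP
import Data.Integer.Solver as ℤSolver
open import Data.Rational as ℚ using (ℚ; mkℚ; ↥_; ↧_; ↧ₙ_; 0ℚ; 1ℚ)
import Data.Rational.Properties as ℚP
import Data.Rational.Solver as ℚSolver
import Data.Rational.Unnormalised as ℚᵘ
open import Data.List using ([]; _∷_)
open import Data.Product using (Σ; _×_; _,_; proj₁; proj₂; map₂)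
open import Data.Sum using (_⊎_; inj₁; inj₂)
open import Data.Empty using (⊥-elim)
open import Relation.Nullary using (¬_; yes; no)
open import Relation.Binary.PropositionalEquality
open import Relation.Binary.Definitions using (tri<; tri≈; tri>)
open import Function using (_∘_)
open import Algebra.Bundles using (CommutativeMonoid)
import Algebra.Properties.CommutativeSemigroup as CommutativeSemigroupProperties
open import Algebra.Properties.CommutativeSemigroup +-commutativeSemigroup using () renaming (interchange to +-interchange)

module ℕ* = CommutativeSemigroupProperties *-commutativeSemigroup
module ℚ* = CommutativeSemigroupProperties (CommutativeMonoid.commutativeSemigroup ℚP.*-1-commutativeMonoid)

[m+n]∸[o+q]≤[m∸o]+[n∸q] : ∀ m n o q → (m + n) ∸ (o + q) ≤ (m ∸ o) + (n ∸ q)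
[m+n]∸[o+q]≤[m∸o]+[n∸q] m n o q = m≤n+o⇒m∸n≤o (m + n) (o + q) (begin
  m + n                           ≤⟨ +-mono-≤ (m≤n+m∸n m o) (m≤n+m∸n n q) ⟩
  o + (m ∸ o) + (q + (n ∸ q))     ≡⟨ +-interchange o (m ∸ o) q (n ∸ q) ⟩
  o + q + ((m ∸ o) + (n ∸ q))     ∎)
  where open ≤-Reasoning

-- d·e − i = (d·t − i) + d·(e − t), and the first summand may be multiplied by e ≥ 1.
r[de∸i]≤r[e∸t]d+r[dt∸i]e : ∀ r {d t e i} → i ≤ d * t → t ≤ e → 0 < e →
                           r * (d * e ∸ i) ≤ r * (e ∸ t) * d + r * (d * t ∸ i) * e
r[de∸i]≤r[e∸t]d+r[dt∸i]e r {d} {t} {e} {i} i≤dt t≤e 0<e = begin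
  r * (d * e ∸ i)              ≡⟨ cong (r *_) de∸i≡ ⟩
  r * (x + d * u)              ≡⟨ solve 4 (λ r x d u → r :* (x :+ d :* u) := r :* u :* d :+ r :* x) refl r x d u ⟩
  r * u * d + r * x            ≤⟨ +-monoʳ-≤ (r * u * d) (m≤m*n (r * x) e {{ℕ.>-nonZero 0<e}}) ⟩
  r * u * d + r * x * e        ∎
  where
  open ≤-Reasoning
  open ℕSolver.+-*-Solver
  x = d * t ∸ i
  u = e ∸ t
  de∸i≡ : d * e ∸ i ≡ x + d * u
  de∸i≡ = begin-equality
    d * e ∸ i              ≡⟨ cong (λ v → d * v ∸ i) (sym (m+[n∸m]≡n t≤e)) ⟩
    d * (t + u) ∸ i        ≡⟨ cong (_∸ i) (*-distribˡ-+ d t u) ⟩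
    d * t + d * u ∸ i      ≡⟨ +-∸-comm (d * u) i≤dt ⟩
    x + d * u              ∎

↥≃-cross : ∀ a x → ℚ.toℚᵘ a ℚᵘ.≃ x → ↥ a ℤ.* ℚᵘ.↧ x ≡ ℚᵘ.↥ x ℤ.* ↧ a
↥≃-cross (mkℚ _ _ _) _ (ℚᵘ.*≡* eq) = eq

↥+-cross : ∀ a b → ↥ (a ℚ.+ b) ℤ.* (↧ a ℤ.* ↧ b) ≡ (↥ a ℤ.* ↧ b ℤ.+ ↥ b ℤ.* ↧ a) ℤ.* ↧ (a ℚ.+ b)
↥+-cross a@(mkℚ _ da _) b@(mkℚ _ db _) =
  trans (cong (↥ (a ℚ.+ b) ℤ.*_) (ℤP.pos-* (suc da) (suc db))) (↥≃-cross (a ℚ.+ b) _ (ℚP.toℚᵘ-homo-+ a b))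

↥*-cross : ∀ a b → ↥ (a ℚ.* b) ℤ.* (↧ a ℤ.* ↧ b) ≡ (↥ a ℤ.* ↥ b) ℤ.* ↧ (a ℚ.* b)
↥*-cross a@(mkℚ _ da _) b@(mkℚ _ db _) =
  trans (cong (↥ (a ℚ.* b) ℤ.*_) (ℤP.pos-* (suc da) (suc db))) (↥≃-cross (a ℚ.* b) _ (ℚP.toℚᵘ-homo-* a b))

infixr 8 _^ℚ_
_^ℚ_ : ℚ → ℕ → ℚ
a ^ℚ zero  = 1ℚ
a ^ℚ suc n = a ℚ.* a ^ℚ n

module Valuation (p-2 : ℕ) (p-prime : Prime (suc (suc p-2))) where

  p : ℕ
  p = suc (suc p-2)

  p∤1 : ¬ p ∣ 1
  p∤1 p∣1 with ∣1⇒≡1 p∣1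
  ... | ()

  p∤* : ∀ {x y} → ¬ p ∣ x → ¬ p ∣ y → ¬ p ∣ x * y
  p∤* {x} {y} p∤x p∤y p∣xy with euclidsLemma x y p-prime p∣xy
  ... | inj₁ p∣x = p∤x p∣x
  ... | inj₂ p∣y = p∤y p∣y

  p∤⇒>0 : ∀ {u} → ¬ p ∣ u → 0 < u
  p∤⇒>0 {zero}  p∤0 = ⊥-elim (p∤0 (divides 0 refl))
  p∤⇒>0 {suc u} _   = s≤s z≤n

  j<p^j : ∀ j → j < p ^ j
  j<p^j zero    = s≤s z≤n
  j<p^j (suc j) = ≤-<-trans (j<p^j j)
    (subst (p ^ j <_) (*-comm (p ^ j) p) (m<m*n (p ^ j) p {{m^n≢0 p j}} (s≤s (s≤s z≤n))))

  p^j*u*p≡p^[1+j]*u : ∀ j u → p ^ j * u * p ≡ p ^ suc j * u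
  p^j*u*p≡p^[1+j]*u j u = trans (*-comm (p ^ j * u) p) (sym (*-assoc p (p ^ j) u))

  νgo-p^j*u : ∀ fuel j u → ¬ p ∣ u → j < fuel → νgo fuel p-2 (p ^ j * u) ≡ j
  νgo-p^j*u (suc fuel) zero u p∤u _ with p ∣? (p ^ 0 * u)
  ... | yes p∣u = ⊥-elim (p∤u (subst (p ∣_) (*-identityˡ u) p∣u))
  ... | no  _   = refl
  νgo-p^j*u (suc fuel) (suc j) u p∤u (s≤s j<fuel) with p ∣? (p ^ suc j * u)
  ... | yes _ = cong suc (trans (cong (νgo fuel p-2) quotient) (νgo-p^j*u fuel j u p∤u j<fuel))
    where
    quotient : p ^ suc j * u / p ≡ p ^ j * u
    quotient = trans (cong (_/ p) (sym (p^j*u*p≡p^[1+j]*u j u))) (m*n/n≡m (p ^ j * u) p)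
  ... | no p∤ = ⊥-elim (p∤ (divides (p ^ j * u) (sym (p^j*u*p≡p^[1+j]*u j u))))

  νℕ-p^j*u : ∀ j u → ¬ p ∣ u → νℕ p (p ^ j * u) ≡ j
  νℕ-p^j*u j u p∤u =
    νgo-p^j*u (p ^ j * u) j u p∤u (<-≤-trans (j<p^j j) (m≤m*n (p ^ j) u {{ℕ.>-nonZero (p∤⇒>0 p∤u)}}))

  Factorisation : ℕ → Set
  Factorisation m = Σ ℕ λ j → Σ ℕ λ u → m ≡ p ^ j * u × ¬ p ∣ u

  factorise : ∀ m → 0 < m → Factorisation m
  factorise = <-rec (λ m → 0 < m → Factorisation m) step
    where
    step : ∀ m → (∀ {k} → k < m → 0 < k → Factorisation k) → 0 < m → Factorisation m
    step m rec 0<m with p ∣? m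
    ... | no p∤m = 0 , m , sym (*-identityˡ m) , p∤m
    ... | yes (divides zero m≡0) = ⊥-elim (<-irrefl (sym m≡0) 0<m)
    ... | yes (divides (suc k) m≡k*p) with rec (subst (suc k <_) (sym m≡k*p) (m<m*n (suc k) p (s≤s (s≤s z≤n)))) (s≤s z≤n)
    ...   | j , u , k≡ , p∤u = suc j , u , trans m≡k*p (trans (cong (_* p) k≡) (p^j*u*p≡p^[1+j]*u j u)) , p∤u

  factoriseℤ : ∀ z → z ≢ + 0 → Σ ℕ λ j → Σ ℤ λ w → z ≡ + (p ^ j) ℤ.* w × ¬ p ∣ ∣ w ∣
  factoriseℤ (+ zero) z≢0 = ⊥-elim (z≢0 refl)
  factoriseℤ (+ suc n) _ with factorise (suc n) (s≤s z≤n)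
  ... | j , u , n≡ , p∤u = j , + u , trans (cong +_ n≡) (ℤP.pos-* (p ^ j) u) , p∤u
  factoriseℤ -[1+ n ] _ with factorise (suc n) (s≤s z≤n)
  ... | j , u , n≡ , p∤u = j , ℤ.- + u ,
        trans (cong ℤ.-_ (trans (cong +_ n≡) (ℤP.pos-* (p ^ j) u))) (ℤP.neg-distribʳ-* (+ (p ^ j)) (+ u)) ,
        subst (λ v → ¬ p ∣ v) (sym (ℤP.∣-i∣≡∣i∣ (+ u))) p∤u

  -- Val≥ k a : a = p^k m / n with p ∤ n, i.e. p^k divides a in ℤ₍ₚ₎.
  -- Val≡ k a additionally has p ∤ m, so that ν_p(a) = k.
  record Val≥ (k : ℕ) (a : ℚ) : Set where
    constructor val≥
    field
      num   : ℤ
      den   : ℕ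
      p∤den : ¬ p ∣ den
      cross : ↥ a ℤ.* + den ≡ + (p ^ k) ℤ.* num ℤ.* ↧ a

  record Val≡ (k : ℕ) (a : ℚ) : Set where
    constructor val≡
    field
      num   : ℤ
      den   : ℕ
      p∤den : ¬ p ∣ den
      p∤num : ¬ p ∣ ∣ num ∣
      cross : ↥ a ℤ.* + den ≡ + (p ^ k) ℤ.* num ℤ.* ↧ a

  Val≡⇒Val≥ : ∀ {k a} → Val≡ k a → Val≥ k a
  Val≡⇒Val≥ (val≡ m n p∤n _ eq) = val≥ m n p∤n eq

  ∣↥∣*n≡p^k*∣m∣*↧ : ∀ {k a m n} → ↥ a ℤ.* + n ≡ + (p ^ k) ℤ.* m ℤ.* ↧ a →
                    ∣ ↥ a ∣ * n ≡ p ^ k * ∣ m ∣ * ↧ₙ a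
  ∣↥∣*n≡p^k*∣m∣*↧ {k} {a} {m} {n} eq =
    trans (sym (ℤP.abs-* (↥ a) (+ n))) (trans (cong ∣_∣ eq)
      (trans (ℤP.abs-* (+ (p ^ k) ℤ.* m) (↧ a)) (cong (_* ↧ₙ a) (ℤP.abs-* (+ (p ^ k)) m))))

  Val≡⇒∣↥∣>0 : ∀ {k a} → Val≡ k a → 0 < ∣ ↥ a ∣
  Val≡⇒∣↥∣>0 {k} {a} (val≡ m n _ p∤m eq) with ∣ ↥ a ∣ | ∣↥∣*n≡p^k*∣m∣*↧ {k} {a} eq
  ... | zero  | 0≡ = ⊥-elim (<-irrefl 0≡ (*-mono-< (*-mono-< (m^n>0 p k) (p∤⇒>0 p∤m)) (s≤s z≤n)))
  ... | suc _ | _  = s≤s z≤n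

  Val≡⇒≢0 : ∀ {k a} → Val≡ k a → a ≢ 0ℚ
  Val≡⇒≢0 v refl with Val≡⇒∣↥∣>0 v
  ... | ()

  Val≡⇒ν≡ : ∀ {k a} → Val≡ k a → ν p a ≡ + k
  Val≡⇒ν≡ {k} {a} v@(val≡ m n p∤n p∤m eq)
    with factorise ∣ ↥ a ∣ (Val≡⇒∣↥∣>0 v) | factorise (↧ₙ a) (s≤s z≤n)
  ... | α , x , ↥≡ , p∤x | β , y , ↧≡ , p∤y = begin
    + νℕ p ∣ ↥ a ∣ ℤ.- + νℕ p (↧ₙ a)     ≡⟨ cong₂ (λ u v → + u ℤ.- + v) (ν↥ α x ↥≡ p∤x) (ν↥ β y ↧≡ p∤y) ⟩
    + α ℤ.- + β                          ≡⟨ cong (λ u → + u ℤ.- + β) α≡k+β ⟩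
    + (k + β) ℤ.- + β                    ≡⟨ ℤP.[+m]-[+n]≡m⊖n (k + β) β ⟩
    (k + β) ℤ.⊖ β                        ≡⟨ ℤP.⊖-≥ (m≤n+m β k) ⟩
    + (k + β ∸ β)                        ≡⟨ cong +_ (m+n∸n≡m k β) ⟩
    + k                                  ∎
    where
    open ≡-Reasoning
    ν↥ : ∀ {z} j u → z ≡ p ^ j * u → ¬ p ∣ u → νℕ p z ≡ j
    ν↥ j u refl p∤u = νℕ-p^j*u j u p∤u
    open ℕSolver.+-*-Solver
    both : p ^ α * (x * n) ≡ p ^ (k + β) * (∣ m ∣ * y)
    both = begin
      p ^ α * (x * n)           ≡⟨ sym (*-assoc (p ^ α) x n) ⟩
      p ^ α * x * n             ≡⟨ cong (_* n) (sym ↥≡) ⟩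
      ∣ ↥ a ∣ * n               ≡⟨ ∣↥∣*n≡p^k*∣m∣*↧ {k} {a} eq ⟩
      p ^ k * ∣ m ∣ * ↧ₙ a      ≡⟨ cong (p ^ k * ∣ m ∣ *_) ↧≡ ⟩
      p ^ k * ∣ m ∣ * (p ^ β * y) ≡⟨ solve 4 (λ K M B Y → K :* M :* (B :* Y) := K :* B :* (M :* Y)) refl (p ^ k) ∣ m ∣ (p ^ β) y ⟩
      p ^ k * p ^ β * (∣ m ∣ * y) ≡⟨ cong (_* (∣ m ∣ * y)) (sym (^-distribˡ-+-* p k β)) ⟩
      p ^ (k + β) * (∣ m ∣ * y) ∎
    α≡k+β : α ≡ k + β
    α≡k+β = trans (sym (νℕ-p^j*u α (x * n) (p∤* p∤x p∤n)))
              (trans (cong (νℕ p) both) (νℕ-p^j*u (k + β) (∣ m ∣ * y) (p∤* p∤m p∤y)))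

  ∣↥∣⊥↧ : ∀ a → Coprime ∣ ↥ a ∣ (↧ₙ a)
  ∣↥∣⊥↧ (mkℚ n d c) = Coprimality.recompute c

  ν≡⇒Val≡ : ∀ {k a} → a ≢ 0ℚ → ν p a ≡ + k → Val≡ k a
  ν≡⇒Val≡ {k} {a} a≢0 νa≡k
    with factoriseℤ (↥ a) (λ ↥a≡0 → a≢0 (ℚP.↥p≡0⇒p≡0 a ↥a≡0)) | factorise (↧ₙ a) (s≤s z≤n)
  ... | α , w , ↥≡ , p∤w | β , y , ↧≡ , p∤y = build α β ↥≡ ↧≡ α-β≡k
    where
    ∣↥∣≡ : ∀ α → ↥ a ≡ + (p ^ α) ℤ.* w → ∣ ↥ a ∣ ≡ p ^ α * ∣ w ∣
    ∣↥∣≡ α eq = trans (cong ∣_∣ eq) (ℤP.abs-* (+ (p ^ α)) w)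

    α-β≡k : + α ℤ.- + β ≡ + k
    α-β≡k = trans (sym (cong₂ (λ u v → + u ℤ.- + v)
                    (trans (cong (νℕ p) (∣↥∣≡ α ↥≡)) (νℕ-p^j*u α ∣ w ∣ p∤w))
                    (trans (cong (νℕ p) ↧≡) (νℕ-p^j*u β y p∤y))))
              νa≡k

    build : ∀ α β → ↥ a ≡ + (p ^ α) ℤ.* w → ↧ₙ a ≡ p ^ β * y → + α ℤ.- + β ≡ + k → Val≡ k a
    build α zero ↥≡ ↧≡ α≡k = val≡ w (↧ₙ a) p∤↧ p∤w (cong (ℤ._* ↧ a) ↥≡p^k*w)
      where
      p∤↧ : ¬ p ∣ ↧ₙ a
      p∤↧ = subst (λ v → ¬ p ∣ v) (sym (trans ↧≡ (*-identityˡ y))) p∤y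
      ↥≡p^k*w : ↥ a ≡ + (p ^ k) ℤ.* w
      ↥≡p^k*w = trans ↥≡ (cong (λ j → + (p ^ j) ℤ.* w) (ℤP.+-injective (trans (sym (ℤP.+-identityʳ (+ α))) α≡k)))
    build zero    (suc β) _ _ ()
    build (suc α) (suc β) ↥≡ ↧≡ _ with ∣↥∣⊥↧ a (p∣∣↥∣ , p∣↧)
      where
      p∣∣↥∣ : p ∣ ∣ ↥ a ∣
      p∣∣↥∣ = subst (p ∣_) (sym (∣↥∣≡ (suc α) ↥≡)) (∣-trans (m∣m*n (p ^ α)) (m∣m*n ∣ w ∣))
      p∣↧ : p ∣ ↧ₙ a
      p∣↧ = subst (p ∣_) (sym ↧≡) (∣-trans (m∣m*n (p ^ β)) (m∣m*n y))
    ... | ()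

  Val≥⇒≤ν : ∀ {k a} → a ≢ 0ℚ → Val≥ k a → + k ℤ.≤ ν p a
  Val≥⇒≤ν {k} {a} a≢0 (val≥ m n p∤n eq) with m ℤ.≟ + 0
  ... | yes refl = ⊥-elim (a≢0 (ℚP.↥p≡0⇒p≡0 a (ℤP.*-cancelʳ-≡ (↥ a) (+ 0) (+ n) {{n≢0}} ↥a*n≡0)))
    where
    n≢0 : ℤ.NonZero (+ n)
    n≢0 = ℤ.>-nonZero (ℤ.+<+ (p∤⇒>0 p∤n))
    ↥a*n≡0 : ↥ a ℤ.* + n ≡ + 0 ℤ.* + n
    ↥a*n≡0 = trans eq (cong (ℤ._* ↧ a) (ℤP.*-zeroʳ (+ (p ^ k))))
  ... | no m≢0 with factoriseℤ m m≢0
  ... | j , w , m≡ , p∤w = subst (+ k ℤ.≤_) (sym (Val≡⇒ν≡ {a = a} (val≡ w n p∤n p∤w (trans eq (cong (ℤ._* ↧ a) p^k*m≡)))))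
                             (+≤+ (m≤m+n k j))
    where
    p^k*m≡ : + (p ^ k) ℤ.* m ≡ + (p ^ (k + j)) ℤ.* w
    p^k*m≡ = begin
      + (p ^ k) ℤ.* m                  ≡⟨ cong (+ (p ^ k) ℤ.*_) m≡ ⟩
      + (p ^ k) ℤ.* (+ (p ^ j) ℤ.* w)  ≡⟨ sym (ℤP.*-assoc (+ (p ^ k)) _ w) ⟩
      + (p ^ k) ℤ.* + (p ^ j) ℤ.* w    ≡⟨ cong (ℤ._* w) (sym (ℤP.pos-* (p ^ k) (p ^ j))) ⟩
      + (p ^ k * p ^ j) ℤ.* w          ≡⟨ cong (λ v → + v ℤ.* w) (sym (^-distribˡ-+-* p k j)) ⟩
      + (p ^ (k + j)) ℤ.* w            ∎
      where open ≡-Reasoning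

  Val≥-0 : ∀ k → Val≥ k 0ℚ
  Val≥-0 k = val≥ (+ 0) 1 p∤1 (sym (cong (ℤ._* + 1) (ℤP.*-zeroʳ (+ (p ^ k)))))

  Val≡-1 : Val≡ 0 1ℚ
  Val≡-1 = val≡ (+ 1) 1 p∤1 p∤1 refl

  p^_ℚ : ℕ → ℚ
  p^ k ℚ = mkℚ (+ (p ^ k)) 0 (Coprimality.sym (1-coprimeTo (p ^ k)))

  Val≡-p^ℚ : ∀ k → Val≡ k (p^ k ℚ)
  Val≡-p^ℚ k = val≡ (+ 1) 1 p∤1 p∤1 (sym (ℤP.*-identityʳ (+ (p ^ k) ℤ.* + 1)))

  Val≥-weaken : ∀ {j k a} → j ≤ k → Val≥ k a → Val≥ j a
  Val≥-weaken {j} {k} {a} j≤k (val≥ m n p∤n eq) = val≥ (+ (p ^ (k ∸ j)) ℤ.* m) n p∤n (trans eq (cong (ℤ._* ↧ a) split))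
    where
    split : + (p ^ k) ℤ.* m ≡ + (p ^ j) ℤ.* (+ (p ^ (k ∸ j)) ℤ.* m)
    split = begin
      + (p ^ k) ℤ.* m                          ≡⟨ cong (λ v → + (p ^ v) ℤ.* m) (sym (m+[n∸m]≡n j≤k)) ⟩
      + (p ^ (j + (k ∸ j))) ℤ.* m              ≡⟨ cong (λ v → + v ℤ.* m) (^-distribˡ-+-* p j (k ∸ j)) ⟩
      + (p ^ j * p ^ (k ∸ j)) ℤ.* m            ≡⟨ cong (ℤ._* m) (ℤP.pos-* (p ^ j) (p ^ (k ∸ j))) ⟩
      + (p ^ j) ℤ.* + (p ^ (k ∸ j)) ℤ.* m      ≡⟨ ℤP.*-assoc (+ (p ^ j)) _ m ⟩
      + (p ^ j) ℤ.* (+ (p ^ (k ∸ j)) ℤ.* m)    ∎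
      where open ≡-Reasoning

  Val≥-+ : ∀ {k a b} → Val≥ k a → Val≥ k b → Val≥ k (a ℚ.+ b)
  Val≥-+ {k} {a@(mkℚ na _ _)} {b@(mkℚ nb _ _)} (val≥ m n p∤n eqa) (val≥ m′ n′ p∤n′ eqb) =
    val≥ (m ℤ.* + n′ ℤ.+ m′ ℤ.* + n) (n * n′) (p∤* p∤n p∤n′) (ℤP.*-cancelʳ-≡ _ _ (A ℤ.* B) eq)
    where
    open ℤSolver.+-*-Solver
    K = + (p ^ k)
    N = ↥ (a ℚ.+ b)
    S = ↧ (a ℚ.+ b)
    A = ↧ a
    B = ↧ b
    eq : N ℤ.* + (n * n′) ℤ.* (A ℤ.* B) ≡ K ℤ.* (m ℤ.* + n′ ℤ.+ m′ ℤ.* + n) ℤ.* S ℤ.* (A ℤ.* B)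
    eq = begin
      N ℤ.* + (n * n′) ℤ.* (A ℤ.* B)
        ≡⟨ cong (λ v → N ℤ.* v ℤ.* (A ℤ.* B)) (ℤP.pos-* n n′) ⟩
      N ℤ.* (+ n ℤ.* + n′) ℤ.* (A ℤ.* B)
        ≡⟨ solve 5 (λ N n n′ A B → N :* (n :* n′) :* (A :* B) := N :* (A :* B) :* (n :* n′)) refl N (+ n) (+ n′) A B ⟩
      N ℤ.* (A ℤ.* B) ℤ.* (+ n ℤ.* + n′)
        ≡⟨ cong (ℤ._* (+ n ℤ.* + n′)) (↥+-cross a b) ⟩
      (na ℤ.* B ℤ.+ nb ℤ.* A) ℤ.* S ℤ.* (+ n ℤ.* + n′)
        ≡⟨ solve 7 (λ na nb A B S n n′ → (na :* B :+ nb :* A) :* S :* (n :* n′)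
                                       := (na :* n :* B :* n′ :+ nb :* n′ :* A :* n) :* S)
                 refl na nb A B S (+ n) (+ n′) ⟩
      (na ℤ.* + n ℤ.* B ℤ.* + n′ ℤ.+ nb ℤ.* + n′ ℤ.* A ℤ.* + n) ℤ.* S
        ≡⟨ cong₂ (λ u v → (u ℤ.* B ℤ.* + n′ ℤ.+ v ℤ.* A ℤ.* + n) ℤ.* S) eqa eqb ⟩
      (K ℤ.* m ℤ.* A ℤ.* B ℤ.* + n′ ℤ.+ K ℤ.* m′ ℤ.* B ℤ.* A ℤ.* + n) ℤ.* S
        ≡⟨ solve 8 (λ K m m′ A B S n n′ → (K :* m :* A :* B :* n′ :+ K :* m′ :* B :* A :* n) :* S
                                        := K :* (m :* n′ :+ m′ :* n) :* S :* (A :* B))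
                 refl K m m′ A B S (+ n) (+ n′) ⟩
      K ℤ.* (m ℤ.* + n′ ℤ.+ m′ ℤ.* + n) ℤ.* S ℤ.* (A ℤ.* B) ∎
      where open ≡-Reasoning

  Val≥-* : ∀ {k k′ a b} → Val≥ k a → Val≥ k′ b → Val≥ (k + k′) (a ℚ.* b)
  Val≥-* {k} {k′} {a@(mkℚ na _ _)} {b@(mkℚ nb _ _)} (val≥ m n p∤n eqa) (val≥ m′ n′ p∤n′ eqb) =
    val≥ (m ℤ.* m′) (n * n′) (p∤* p∤n p∤n′) (ℤP.*-cancelʳ-≡ _ _ (A ℤ.* B) eq)
    where
    open ℤSolver.+-*-Solver
    K = + (p ^ k)
    K′ = + (p ^ k′)
    N = ↥ (a ℚ.* b)
    S = ↧ (a ℚ.* b)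
    A = ↧ a
    B = ↧ b
    eq : N ℤ.* + (n * n′) ℤ.* (A ℤ.* B) ≡ + (p ^ (k + k′)) ℤ.* (m ℤ.* m′) ℤ.* S ℤ.* (A ℤ.* B)
    eq = begin
      N ℤ.* + (n * n′) ℤ.* (A ℤ.* B)
        ≡⟨ cong (λ v → N ℤ.* v ℤ.* (A ℤ.* B)) (ℤP.pos-* n n′) ⟩
      N ℤ.* (+ n ℤ.* + n′) ℤ.* (A ℤ.* B)
        ≡⟨ solve 5 (λ N n n′ A B → N :* (n :* n′) :* (A :* B) := N :* (A :* B) :* (n :* n′)) refl N (+ n) (+ n′) A B ⟩
      N ℤ.* (A ℤ.* B) ℤ.* (+ n ℤ.* + n′)
        ≡⟨ cong (ℤ._* (+ n ℤ.* + n′)) (↥*-cross a b) ⟩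
      na ℤ.* nb ℤ.* S ℤ.* (+ n ℤ.* + n′)
        ≡⟨ solve 5 (λ na nb S n n′ → na :* nb :* S :* (n :* n′) := na :* n :* (nb :* n′) :* S) refl na nb S (+ n) (+ n′) ⟩
      na ℤ.* + n ℤ.* (nb ℤ.* + n′) ℤ.* S
        ≡⟨ cong₂ (λ u v → u ℤ.* v ℤ.* S) eqa eqb ⟩
      K ℤ.* m ℤ.* A ℤ.* (K′ ℤ.* m′ ℤ.* B) ℤ.* S
        ≡⟨ solve 7 (λ K K′ m m′ A B S → K :* m :* A :* (K′ :* m′ :* B) :* S := K :* K′ :* (m :* m′) :* S :* (A :* B))
                 refl K K′ m m′ A B S ⟩
      K ℤ.* K′ ℤ.* (m ℤ.* m′) ℤ.* S ℤ.* (A ℤ.* B)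
        ≡⟨ cong (λ v → v ℤ.* (m ℤ.* m′) ℤ.* S ℤ.* (A ℤ.* B)) (sym p^[k+k′]) ⟩
      + (p ^ (k + k′)) ℤ.* (m ℤ.* m′) ℤ.* S ℤ.* (A ℤ.* B) ∎
      where
      open ≡-Reasoning
      p^[k+k′] : + (p ^ (k + k′)) ≡ K ℤ.* K′
      p^[k+k′] = trans (cong +_ (^-distribˡ-+-* p k k′)) (ℤP.pos-* (p ^ k) (p ^ k′))

  Val≡-* : ∀ {k k′ a b} → Val≡ k a → Val≡ k′ b → Val≡ (k + k′) (a ℚ.* b)
  Val≡-* {a = mkℚ _ _ _} {b = mkℚ _ _ _} u@(val≡ m n p∤n p∤m _) v@(val≡ m′ n′ p∤n′ p∤m′ _) =
    val≡ (m ℤ.* m′) (n * n′) (p∤* p∤n p∤n′) (subst (λ v → ¬ p ∣ v) (sym (ℤP.abs-* m m′)) (p∤* p∤m p∤m′))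
         (Val≥.cross (Val≥-* (Val≡⇒Val≥ u) (Val≡⇒Val≥ v)))

  Val≡-^ℚ : ∀ {a} → Val≡ 0 a → ∀ n → Val≡ 0 (a ^ℚ n)
  Val≡-^ℚ a-unit zero    = Val≡-1
  Val≡-^ℚ a-unit (suc n) = Val≡-* a-unit (Val≡-^ℚ a-unit n)

coeff-⊕ : ∀ g h i → coeff (g ⊕ h) i ≡ coeff g i ℚ.+ coeff h i
coeff-⊕ []      h       i       = sym (ℚP.+-identityˡ (coeff h i))
coeff-⊕ (a ∷ g) []      i       = sym (ℚP.+-identityʳ (coeff (a ∷ g) i))
coeff-⊕ (a ∷ g) (b ∷ h) zero    = refl
coeff-⊕ (a ∷ g) (b ∷ h) (suc i) = coeff-⊕ g h i

coeff-scale : ∀ c h i → coeff (scale c h) i ≡ c ℚ.* coeff h i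
coeff-scale c []      i       = sym (ℚP.*-zeroʳ c)
coeff-scale c (a ∷ h) zero    = refl
coeff-scale c (a ∷ h) (suc i) = coeff-scale c h i

coeff-∷⊗ : ∀ a g h i → coeff ((a ∷ g) ⊗ h) i ≡ a ℚ.* coeff h i ℚ.+ coeff (0ℚ ∷ (g ⊗ h)) i
coeff-∷⊗ a g h i = trans (coeff-⊕ (scale a h) (0ℚ ∷ (g ⊗ h)) i) (cong (ℚ._+ _) (coeff-scale a h i))

coeff-⊗[] : ∀ f i → coeff (f ⊗ []) i ≡ 0ℚ
coeff-⊗[] []      i       = refl
coeff-⊗[] (a ∷ f) zero    = refl
coeff-⊗[] (a ∷ f) (suc i) = coeff-⊗[] f i

coeff-⊕const : ∀ h c {i} → 0 < i → coeff (h ⊕ const c) i ≡ coeff h i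
coeff-⊕const h c {suc i} _ = trans (coeff-⊕ h (const c) (suc i)) (ℚP.+-identityʳ (coeff h (suc i)))

coeff-monomial-≡ : ∀ a n → coeff (monomial a n) n ≡ a
coeff-monomial-≡ a zero    = refl
coeff-monomial-≡ a (suc n) = coeff-monomial-≡ a n

coeff-monomial-≢ : ∀ a n i → i ≢ n → coeff (monomial a n) i ≡ 0ℚ
coeff-monomial-≢ a zero    zero    i≢n = ⊥-elim (i≢n refl)
coeff-monomial-≢ a zero    (suc i) _   = refl
coeff-monomial-≢ a (suc n) zero    _   = refl
coeff-monomial-≢ a (suc n) (suc i) i≢n = coeff-monomial-≢ a n i (i≢n ∘ cong suc)

-- Holds w a: "the coefficient a has weight at least w"; weights add up under products.
record WeightedPredicate : Set₁ where
  field
    Holds   : ℕ → ℚ → Set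
    holds-0 : ∀ w → Holds w 0ℚ
    holds-+ : ∀ {w a b} → Holds w a → Holds w b → Holds w (a ℚ.+ b)
    holds-* : ∀ {u v w a b} → w ≤ u + v → Holds u a → Holds v b → Holds w (a ℚ.* b)

module _ (P : WeightedPredicate) where
  open WeightedPredicate P

  holds-⊗ : ∀ g h {U V W : ℕ → ℕ} → (∀ i j → W (i + j) ≤ U i + V j) →
            (∀ i → Holds (U i) (coeff g i)) → (∀ i → Holds (V i) (coeff h i)) →
            ∀ i → Holds (W i) (coeff (g ⊗ h) i)
  holds-⊗ []      h {W = W} _ _ _ i = holds-0 (W i)
  holds-⊗ (a ∷ g) h {U} {V} {W} W≤U+V hg hh i =
    subst (Holds (W i)) (sym (coeff-∷⊗ a g h i)) (holds-+ (holds-* (W≤U+V 0 i) (hg 0) (hh i)) (shifted i))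
    where
    shifted : ∀ i → Holds (W i) (coeff (0ℚ ∷ (g ⊗ h)) i)
    shifted zero    = holds-0 (W 0)
    shifted (suc i) = holds-⊗ g h {W = W ∘ suc} (λ i j → W≤U+V (suc i) j) (λ i → hg (suc i)) hh i

  -- monomial b (suc t) ∘ₚ f unfolds to const 0ℚ ⊕ (f ⊗ (monomial b t ∘ₚ f)), i.e. b fᵗ⁺¹ = f · b fᵗ.
  holds-monomial∘ : ∀ f b {U : ℕ → ℕ} {W : ℕ → ℕ → ℕ} → (∀ t i j → W (suc t) (i + j) ≤ U i + W t j) →
                    Holds (W 0 0) b → (∀ i → Holds (U i) (coeff f i)) →
                    ∀ t i → Holds (W t i) (coeff (monomial b t ∘ₚ f) i)
  holds-monomial∘ f b {W = W} _ hb _ zero i =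
    subst (Holds (W 0 i)) (sym (coeff-⊕ (const b) (f ⊗ []) i))
      (holds-+ (constant i) (subst (Holds (W 0 i)) (sym (coeff-⊗[] f i)) (holds-0 (W 0 i))))
    where
    constant : ∀ i → Holds (W 0 i) (coeff (const b) i)
    constant zero    = hb
    constant (suc i) = holds-0 (W 0 (suc i))
  holds-monomial∘ f b {W = W} W≤U+W hb hf (suc t) i =
    subst (Holds (W (suc t) i)) (sym (coeff-⊕ (const 0ℚ) (f ⊗ (monomial b t ∘ₚ f)) i))
      (holds-+ (zero-constant i) (holds-⊗ f (monomial b t ∘ₚ f) {W = W (suc t)} (W≤U+W t) hf (holds-monomial∘ f b W≤U+W hb hf t) i))
    where
    zero-constant : ∀ i → Holds (W (suc t) i) (coeff (const 0ℚ) i)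
    zero-constant zero    = holds-0 (W (suc t) 0)
    zero-constant (suc i) = holds-0 (W (suc t) (suc i))

HasDegree-unique : ∀ {f d n} → HasDegree f d → HasDegree f n → n ≡ d
HasDegree-unique {d = d} {n} (fd≢0 , f≤d) (fn≢0 , f≤n) with <-cmp n d
... | tri< n<d _ _ = ⊥-elim (fd≢0 (f≤n d n<d))
... | tri≈ _ n≡d _ = n≡d
... | tri> _ _ d<n = ⊥-elim (fn≢0 (f≤d n d<n))

Deg≤ : Poly → ℕ → Set
Deg≤ g D = ∀ i → D < i → coeff g i ≡ 0ℚ

-- Positive weight forces a zero coefficient; with weights i ∸ D this expresses Deg≤ _ D.
vanishing : WeightedPredicate
vanishing = record
  { Holds   = λ w a → 0 < w → a ≡ 0ℚ
  ; holds-0 = λ _ _ → refl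
  ; holds-+ = λ {_} {a} {b} a≡0 b≡0 0<w → trans (cong₂ ℚ._+_ (a≡0 0<w) (b≡0 0<w)) (ℚP.+-identityˡ 0ℚ)
  ; holds-* = holds-*
  }
  where
  holds-* : ∀ {u v w a b} → w ≤ u + v → (0 < u → a ≡ 0ℚ) → (0 < v → b ≡ 0ℚ) → 0 < w → a ℚ.* b ≡ 0ℚ
  holds-* {zero}  {a = a} w≤v a≡0 b≡0 0<w = trans (cong (a ℚ.*_) (b≡0 (≤-trans 0<w w≤v))) (ℚP.*-zeroʳ a)
  holds-* {suc _} {b = b} _   a≡0 _   _   = trans (cong (ℚ._* b) (a≡0 (s≤s z≤n))) (ℚP.*-zeroˡ b)

Deg≤⇒vanishing : ∀ {g D} → Deg≤ g D → ∀ i → 0 < i ∸ D → coeff g i ≡ 0ℚ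
Deg≤⇒vanishing g≤D i 0<i∸D = g≤D i (m∸n≢0⇒n<m (>⇒≢ 0<i∸D))

Deg≤-monomial∘ : ∀ f d b → Deg≤ f d → ∀ t → Deg≤ (monomial b t ∘ₚ f) (d * t)
Deg≤-monomial∘ f d b f≤d t i dt<i =
  holds-monomial∘ vanishing f b {U = λ i → i ∸ d} {W = λ t i → i ∸ d * t} W≤U+W b-weight (Deg≤⇒vanishing {f} f≤d) t i
    (m<n⇒0<n∸m dt<i)
  where
  W≤U+W : ∀ t i j → (i + j) ∸ d * suc t ≤ (i ∸ d) + (j ∸ d * t)
  W≤U+W t i j rewrite *-suc d t = [m+n]∸[o+q]≤[m∸o]+[n∸q] i j d (d * t)
  b-weight : 0 < 0 ∸ d * 0 → b ≡ 0ℚ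
  b-weight 0<0 = ⊥-elim (<-irrefl (sym (0∸n≡0 (d * 0))) 0<0)

coeff-⊗-zeroˡ : ∀ g h → (∀ i → coeff g i ≡ 0ℚ) → ∀ i → coeff (g ⊗ h) i ≡ 0ℚ
coeff-⊗-zeroˡ g h g≡0 i =
  holds-⊗ vanishing g h {U = λ _ → 1} {V = λ _ → 0} {W = λ _ → 1} (λ _ _ → ≤-refl) (λ i _ → g≡0 i) (λ _ ()) i (s≤s z≤n)

coeff-⊗-top : ∀ g h {D E} → Deg≤ g D → Deg≤ h E → coeff (g ⊗ h) (D + E) ≡ coeff g D ℚ.* coeff h E
coeff-⊗-top []      h {D} {E} _   _   = sym (ℚP.*-zeroˡ (coeff h E))
coeff-⊗-top (a ∷ g) h {zero} {E} g≤0 _ =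
  trans (coeff-∷⊗ a g h E) (trans (cong (a ℚ.* coeff h E ℚ.+_) (shifted E)) (ℚP.+-identityʳ _))
  where
  shifted : ∀ E → coeff (0ℚ ∷ (g ⊗ h)) E ≡ 0ℚ
  shifted zero    = refl
  shifted (suc E) = coeff-⊗-zeroˡ g h (λ i → g≤0 (suc i) (s≤s z≤n)) E
coeff-⊗-top (a ∷ g) h {suc D} {E} g≤D h≤E = begin
  coeff ((a ∷ g) ⊗ h) (suc (D + E))
    ≡⟨ coeff-∷⊗ a g h (suc (D + E)) ⟩
  a ℚ.* coeff h (suc (D + E)) ℚ.+ coeff (g ⊗ h) (D + E)
    ≡⟨ cong (λ c → a ℚ.* c ℚ.+ coeff (g ⊗ h) (D + E)) (h≤E _ (s≤s (m≤n+m E D))) ⟩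
  a ℚ.* 0ℚ ℚ.+ coeff (g ⊗ h) (D + E)
    ≡⟨ cong (ℚ._+ coeff (g ⊗ h) (D + E)) (ℚP.*-zeroʳ a) ⟩
  0ℚ ℚ.+ coeff (g ⊗ h) (D + E)
    ≡⟨ ℚP.+-identityˡ _ ⟩
  coeff (g ⊗ h) (D + E)
    ≡⟨ coeff-⊗-top g h (λ i D<i → g≤D (suc i) (s≤s D<i)) h≤E ⟩
  coeff g D ℚ.* coeff h E
    ∎
  where open ≡-Reasoning

coeff-monomial∘-top : ∀ f d b → Deg≤ f d → ∀ t → coeff (monomial b t ∘ₚ f) (d * t) ≡ coeff f d ^ℚ t ℚ.* b
coeff-monomial∘-top f d b f≤d zero rewrite *-zeroʳ d = begin
  coeff (const b ⊕ (f ⊗ [])) 0       ≡⟨ coeff-⊕ (const b) (f ⊗ []) 0 ⟩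
  b ℚ.+ coeff (f ⊗ []) 0             ≡⟨ cong (b ℚ.+_) (coeff-⊗[] f 0) ⟩
  b ℚ.+ 0ℚ                           ≡⟨ ℚP.+-identityʳ b ⟩
  b                                  ≡⟨ sym (ℚP.*-identityˡ b) ⟩
  1ℚ ℚ.* b                           ∎
  where open ≡-Reasoning
coeff-monomial∘-top f d b f≤d (suc t) rewrite *-suc d t = begin
  coeff (const 0ℚ ⊕ (f ⊗ G)) (d + d * t)      ≡⟨ coeff-⊕ (const 0ℚ) (f ⊗ G) (d + d * t) ⟩
  coeff (const 0ℚ) (d + d * t) ℚ.+ coeff (f ⊗ G) (d + d * t)
                                              ≡⟨ cong (ℚ._+ coeff (f ⊗ G) (d + d * t)) (coeff-const0 (d + d * t)) ⟩
  0ℚ ℚ.+ coeff (f ⊗ G) (d + d * t)            ≡⟨ ℚP.+-identityˡ _ ⟩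
  coeff (f ⊗ G) (d + d * t)                   ≡⟨ coeff-⊗-top f G f≤d (Deg≤-monomial∘ f d b f≤d t) ⟩
  lc ℚ.* coeff G (d * t)                      ≡⟨ cong (lc ℚ.*_) (coeff-monomial∘-top f d b f≤d t) ⟩
  lc ℚ.* (lc ^ℚ t ℚ.* b)                      ≡⟨ sym (ℚP.*-assoc lc (lc ^ℚ t) b) ⟩
  lc ^ℚ suc t ℚ.* b                           ∎
  where
  open ≡-Reasoning
  G = monomial b t ∘ₚ f
  lc = coeff f d
  coeff-const0 : ∀ i → coeff (const 0ℚ) i ≡ 0ℚ
  coeff-const0 zero    = refl
  coeff-const0 (suc i) = refl

coeff-const⊕-suc : ∀ a h i → coeff (const a ⊕ h) (suc i) ≡ coeff h (suc i)
coeff-const⊕-suc a []      i = refl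
coeff-const⊕-suc a (b ∷ h) i = refl

coeff-0∷⊗ : ∀ g h k → coeff ((0ℚ ∷ g) ⊗ h) k ≡ coeff (0ℚ ∷ (g ⊗ h)) k
coeff-0∷⊗ g h k =
  trans (coeff-∷⊗ 0ℚ g h k) (trans (cong (ℚ._+ coeff (0ℚ ∷ (g ⊗ h)) k) (ℚP.*-zeroˡ (coeff h k))) (ℚP.+-identityˡ _))

coeff-monomial⊗-< : ∀ b t h k → k < t → coeff (monomial b t ⊗ h) k ≡ 0ℚ
coeff-monomial⊗-< b (suc t) h zero    _         = coeff-0∷⊗ (monomial b t) h 0
coeff-monomial⊗-< b (suc t) h (suc k) (s≤s k<t) =
  trans (coeff-0∷⊗ (monomial b t) h (suc k)) (coeff-monomial⊗-< b t h k k<t)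

coeff-monomial⊗-+ : ∀ b t h j → coeff (monomial b t ⊗ h) (t + j) ≡ b ℚ.* coeff h j
coeff-monomial⊗-+ b zero    h j =
  trans (coeff-∷⊗ b [] h j) (trans (cong (b ℚ.* coeff h j ℚ.+_) (coeff-⊗[] (0ℚ ∷ []) j)) (ℚP.+-identityʳ _))
coeff-monomial⊗-+ b (suc t) h j =
  trans (coeff-0∷⊗ (monomial b t) h (suc (t + j))) (coeff-monomial⊗-+ b t h j)

coeff-∘monomial-* : ∀ f b t → 0 < t → ∀ i → coeff (f ∘ₚ monomial b t) (i * t) ≡ coeff f i ℚ.* b ^ℚ i
coeff-∘monomial-* []      b t _   i = sym (ℚP.*-zeroˡ (b ^ℚ i))
coeff-∘monomial-* (a ∷ f) b t 0<t zero = begin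
  coeff (const a ⊕ (monomial b t ⊗ F)) 0    ≡⟨ coeff-⊕ (const a) (monomial b t ⊗ F) 0 ⟩
  a ℚ.+ coeff (monomial b t ⊗ F) 0          ≡⟨ cong (a ℚ.+_) (coeff-monomial⊗-< b t F 0 0<t) ⟩
  a ℚ.+ 0ℚ                                  ≡⟨ ℚP.+-identityʳ a ⟩
  a                                         ≡⟨ sym (ℚP.*-identityʳ a) ⟩
  a ℚ.* 1ℚ                                  ∎
  where
  open ≡-Reasoning
  F = f ∘ₚ monomial b t
coeff-∘monomial-* (a ∷ f) b t@(suc t-1) 0<t (suc i) = begin
  coeff (const a ⊕ (monomial b t ⊗ F)) (t + i * t)   ≡⟨ coeff-const⊕-suc a (monomial b t ⊗ F) (t-1 + i * t) ⟩
  coeff (monomial b t ⊗ F) (t + i * t)               ≡⟨ coeff-monomial⊗-+ b t F (i * t) ⟩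
  b ℚ.* coeff F (i * t)                              ≡⟨ cong (b ℚ.*_) (coeff-∘monomial-* f b t 0<t i) ⟩
  b ℚ.* (coeff f i ℚ.* b ^ℚ i)                       ≡⟨ ℚ*.x∙yz≈y∙xz b (coeff f i) (b ^ℚ i) ⟩
  coeff f i ℚ.* b ^ℚ suc i                           ∎
  where
  open ≡-Reasoning
  F = f ∘ₚ monomial b t

coeff-∘monomial-∤ : ∀ f b t → 0 < t → ∀ k → ¬ t ∣ k → coeff (f ∘ₚ monomial b t) k ≡ 0ℚ
coeff-∘monomial-∤ []      b t _   k       _   = refl
coeff-∘monomial-∤ (a ∷ f) b t _   zero    t∤0 = ⊥-elim (t∤0 (divides 0 refl))
coeff-∘monomial-∤ (a ∷ f) b t 0<t (suc k) t∤k = begin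
  coeff (const a ⊕ (monomial b t ⊗ F)) (suc k)    ≡⟨ coeff-const⊕-suc a (monomial b t ⊗ F) k ⟩
  coeff (monomial b t ⊗ F) (suc k)                ≡⟨ higher ⟩
  0ℚ                                              ∎
  where
  open ≡-Reasoning
  F = f ∘ₚ monomial b t
  higher : coeff (monomial b t ⊗ F) (suc k) ≡ 0ℚ
  higher with suc k <? t
  ... | yes k<t = coeff-monomial⊗-< b t F (suc k) k<t
  ... | no  k≮t = begin
    coeff (monomial b t ⊗ F) (suc k)              ≡⟨ cong (coeff (monomial b t ⊗ F)) (sym (m+[n∸m]≡n t≤k)) ⟩
    coeff (monomial b t ⊗ F) (t + (suc k ∸ t))    ≡⟨ coeff-monomial⊗-+ b t F (suc k ∸ t) ⟩
    b ℚ.* coeff F (suc k ∸ t)                     ≡⟨ cong (b ℚ.*_) (coeff-∘monomial-∤ f b t 0<t (suc k ∸ t) t∤k∸t) ⟩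
    b ℚ.* 0ℚ                                      ≡⟨ ℚP.*-zeroʳ b ⟩
    0ℚ                                            ∎
    where
    t≤k : t ≤ suc k
    t≤k = ≮⇒≥ k≮t
    t∤k∸t : ¬ t ∣ suc k ∸ t
    t∤k∸t t∣k∸t = t∤k (∣m∸n∣n⇒∣m t t≤k t∣k∸t ∣-refl)

module Purity (p-2 : ℕ) (p-prime : Prime (suc (suc p-2))) where
  open Valuation p-2 p-prime

  -- s · ν(a) ≥ w, witnessed by a lower bound k for ν(a); it holds for every w when a = 0.
  record ScaledVal≥ (s w : ℕ) (a : ℚ) : Set where
    constructor sv≥
    field
      k     : ℕ
      w≤s*k : w ≤ s * k
      val≥k : Val≥ k a

  ScaledVal≥-0 : ∀ {s w} → 0 < s → ScaledVal≥ s w 0ℚ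
  ScaledVal≥-0 {s} {w} 0<s = sv≥ w (m≤n*m w s {{ℕ.>-nonZero 0<s}}) (Val≥-0 w)

  scaledVal : ∀ s → 0 < s → WeightedPredicate
  scaledVal s 0<s = record
    { Holds   = ScaledVal≥ s
    ; holds-0 = λ _ → ScaledVal≥-0 0<s
    ; holds-+ = holds-+
    ; holds-* = λ { w≤u+v (sv≥ k u≤sk a≥k) (sv≥ k′ v≤sk′ b≥k′) →
        sv≥ (k + k′) (≤-trans w≤u+v (≤-trans (+-mono-≤ u≤sk v≤sk′) (≤-reflexive (sym (*-distribˡ-+ s k k′)))))
            (Val≥-* a≥k b≥k′) }
    }
    where
    holds-+ : ∀ {w a b} → ScaledVal≥ s w a → ScaledVal≥ s w b → ScaledVal≥ s w (a ℚ.+ b)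
    holds-+ (sv≥ k w≤sk a≥k) (sv≥ k′ w≤sk′ b≥k′) with k ≤? k′
    ... | yes k≤k′ = sv≥ k  w≤sk  (Val≥-+ a≥k (Val≥-weaken k≤k′ b≥k′))
    ... | no  k≰k′ = sv≥ k′ w≤sk′ (Val≥-+ (Val≥-weaken (≰⇒≥ k≰k′) a≥k) b≥k′)

  ScaledVal≥-weaken : ∀ {s w w′ a} → w′ ≤ w → ScaledVal≥ s w a → ScaledVal≥ s w′ a
  ScaledVal≥-weaken w′≤w (sv≥ k w≤sk a≥k) = sv≥ k (≤-trans w′≤w w≤sk) a≥k

  ScaledVal≥-mono : ∀ {s s′ w a} → s ≤ s′ → ScaledVal≥ s w a → ScaledVal≥ s′ w a
  ScaledVal≥-mono s≤s′ (sv≥ k w≤sk a≥k) = sv≥ k (≤-trans w≤sk (*-monoˡ-≤ k s≤s′)) a≥k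

  ScaledVal≥-scale : ∀ {s w a} e → ScaledVal≥ s w a → ScaledVal≥ (s * e) (w * e) a
  ScaledVal≥-scale {s} {w} e (sv≥ k w≤sk a≥k) = sv≥ k (begin
    w * e      ≤⟨ *-monoˡ-≤ e w≤sk ⟩
    s * k * e  ≡⟨ ℕ*.xy∙z≈xz∙y s k e ⟩
    s * e * k  ∎) a≥k
    where open ≤-Reasoning

  ScaledVal≥-*-unit : ∀ {s w a u} → ScaledVal≥ s w a → Val≡ 0 u → ScaledVal≥ s w (a ℚ.* u)
  ScaledVal≥-*-unit {s} (sv≥ k w≤sk a≥k) u-unit =
    sv≥ (k + 0) (subst (λ j → _ ≤ s * j) (sym (+-identityʳ k)) w≤sk) (Val≥-* a≥k (Val≡⇒Val≥ u-unit))

  ScaledVal≥⇒≤ν : ∀ {s w a} → a ≢ 0ℚ → ScaledVal≥ s w a → + w ℤ.≤ + s ℤ.* ν p a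
  ScaledVal≥⇒≤ν {s} {w} {a} a≢0 (sv≥ k w≤sk a≥k) with ν p a | Val≥⇒≤ν a≢0 a≥k
  ... | + v | +≤+ k≤v = subst (+ w ℤ.≤_) (ℤP.pos-* s v) (+≤+ (≤-trans w≤sk (*-monoʳ-≤ s k≤v)))

  ≤ν⇒ScaledVal≥ : ∀ {s w a} → 0 < s → a ≢ 0ℚ → + w ℤ.≤ + s ℤ.* ν p a → ScaledVal≥ s w a
  ≤ν⇒ScaledVal≥ {s} {w} {a} 0<s a≢0 w≤sν with ν p a in νa≡
  ... | + k = sv≥ k (ℤP.drop‿+≤+ (subst (+ w ℤ.≤_) (sym (ℤP.pos-* s k)) w≤sν)) (Val≡⇒Val≥ (ν≡⇒Val≡ a≢0 νa≡))
  ... | -[1+ k ] with s | w≤sν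
  ...   | suc _ | ()

  ScaledVal≥⇒purity-bound : ∀ {r n i a} → ScaledVal≥ n (r * (n ∸ i)) a →
                            a ≡ 0ℚ ⊎ (+ r ℤ.* + (n ∸ i)) ℤ.≤ (+ n ℤ.* ν p a)
  ScaledVal≥⇒purity-bound {r} {n} {i} {a} a≥ with a ℚP.≟ 0ℚ
  ... | yes a≡0 = inj₁ a≡0
  ... | no  a≢0 = inj₂ (subst (ℤ._≤ + n ℤ.* ν p a) (ℤP.pos-* r (n ∸ i)) (ScaledVal≥⇒≤ν a≢0 a≥))

  purity-bound⇒ScaledVal≥ : ∀ {r n i a} → 0 < n → a ≡ 0ℚ ⊎ (+ r ℤ.* + (n ∸ i)) ℤ.≤ (+ n ℤ.* ν p a) →
                            ScaledVal≥ n (r * (n ∸ i)) a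
  purity-bound⇒ScaledVal≥ 0<n (inj₁ refl) = ScaledVal≥-0 0<n
  purity-bound⇒ScaledVal≥ {r} {n} {i} {a} 0<n (inj₂ bound) with a ℚP.≟ 0ℚ
  ... | yes refl = ScaledVal≥-0 0<n
  ... | no  a≢0  = ≤ν⇒ScaledVal≥ 0<n a≢0 (subst (ℤ._≤ + n ℤ.* ν p a) (sym (ℤP.pos-* r (n ∸ i))) bound)

  record Pure (r n : ℕ) (F : Poly) : Set where
    field
      degree   : HasDegree F n
      leading  : Val≡ 0 (coeff F n)
      constant : Val≡ r (coeff F 0)
      middle   : ∀ i → 0 < i → i < n → ScaledVal≥ n (r * (n ∸ i)) (coeff F i)

  Pure⇒PurePow : ∀ {r n F} → Pure r n F → PurePow p r F
  Pure⇒PurePow {r} {n} {F} record { degree = degree ; leading = leading ; constant = constant ; middle = middle } =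
    n , degree , Val≡⇒ν≡ leading , Val≡⇒≢0 constant , Val≡⇒ν≡ constant ,
    λ i 0<i i<n → ScaledVal≥⇒purity-bound {r} {n} {i} (middle i 0<i i<n)

  PurePow⇒Pure : ∀ {r n F} → 0 < n → HasDegree F n → PurePow p r F → Pure r n F
  PurePow⇒Pure {r} {n} {F} 0<n F-deg (_ , F-deg′ , νlc≡0 , F₀≢0 , νF₀≡r , above) with HasDegree-unique {F} F-deg F-deg′
  ... | refl = record
    { degree   = F-deg
    ; leading  = ν≡⇒Val≡ (proj₁ F-deg) νlc≡0
    ; constant = ν≡⇒Val≡ F₀≢0 νF₀≡r
    ; middle   = middle
    }
    where
    middle : ∀ i → 0 < i → i < n → ScaledVal≥ n (r * (n ∸ i)) (coeff F i)
    middle i 0<i i<n = purity-bound⇒ScaledVal≥ {r} {n} {i} 0<n (above i 0<i i<n)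

  Pure-bounds : ∀ {r n F} → 0 < n → Pure r n F → ∀ i → ScaledVal≥ n (r * (n ∸ i)) (coeff F i)
  Pure-bounds {r} {n} {F} 0<n F-pure zero = sv≥ r (≤-reflexive (*-comm r n)) (Val≡⇒Val≥ (Pure.constant F-pure))
  Pure-bounds {r} {n} {F} 0<n F-pure i@(suc _) with <-cmp i n
  ... | tri< i<n _ _ = Pure.middle F-pure i (s≤s z≤n) i<n
  ... | tri≈ _ refl _ = sv≥ 0 (≤-reflexive r[n∸n]≡n*0) (Val≡⇒Val≥ (Pure.leading F-pure))
    where
    r[n∸n]≡n*0 : r * (n ∸ n) ≡ n * 0
    r[n∸n]≡n*0 = trans (cong (r *_) (n∸n≡0 n)) (trans (*-zeroʳ r) (sym (*-zeroʳ n)))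
  ... | tri> _ _ n<i = subst (ScaledVal≥ n _) (sym (proj₂ (Pure.degree F-pure) i n<i)) (ScaledVal≥-0 0<n)

  Pure-⊕const : ∀ {r n H} → 0 < n → HasDegree H n → Val≡ 0 (coeff H n) →
                (∀ i → 0 < i → i < n → ScaledVal≥ n (r * (n ∸ i)) (coeff H i)) →
                Σ ℚ λ c → Pure r n (H ⊕ const c)
  Pure-⊕const {r} {n} {H} 0<n (lc≢0 , H≤n) lc-unit middle = c , record
    { degree   = subst (_≢ 0ℚ) (sym (same 0<n)) lc≢0 , λ m n<m → trans (same (<-trans 0<n n<m)) (H≤n m n<m)
    ; leading  = subst (Val≡ 0) (sym (same 0<n)) lc-unit
    ; constant = subst (Val≡ r) (sym H₀+c≡p^r) (Val≡-p^ℚ r)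
    ; middle   = λ i 0<i i<n → subst (ScaledVal≥ n _) (sym (same 0<i)) (middle i 0<i i<n)
    }
    where
    open ℚSolver.+-*-Solver
    H₀ = coeff H 0
    c = p^ r ℚ ℚ.- H₀
    same : ∀ {i} → 0 < i → coeff (H ⊕ const c) i ≡ coeff H i
    same = coeff-⊕const H c
    H₀+c≡p^r : coeff (H ⊕ const c) 0 ≡ p^ r ℚ
    H₀+c≡p^r = trans (coeff-⊕ H (const c) 0) (solve 2 (λ x y → x :+ (y :- x) := y) refl H₀ (p^ r ℚ))

  Pure-∘monomial : ∀ {r d f b} t → 0 < t → 0 < d → Val≡ 0 b → Pure r d f → Pure r (d * t) (f ∘ₚ monomial b t)
  Pure-∘monomial {r} {d} {f} {b} t 0<t 0<d b-unit f-pure = record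
    { degree   = Val≡⇒≢0 leading , beyond
    ; leading  = leading
    ; constant = subst (Val≡ r) (sym F₀≡f₀) (Pure.constant f-pure)
    ; middle   = middle
    }
    where
    F = f ∘ₚ monomial b t

    formula : ∀ i → coeff F (i * t) ≡ coeff f i ℚ.* b ^ℚ i
    formula = coeff-∘monomial-* f b t 0<t

    leading : Val≡ 0 (coeff F (d * t))
    leading = subst (Val≡ 0) (sym (formula d)) (Val≡-* (Pure.leading f-pure) (Val≡-^ℚ b-unit d))

    F₀≡f₀ : coeff F 0 ≡ coeff f 0
    F₀≡f₀ = trans (formula 0) (ℚP.*-identityʳ (coeff f 0))

    beyond : ∀ m → d * t < m → coeff F m ≡ 0ℚ
    beyond m dt<m with t ∣? m
    ... | no  t∤m = coeff-∘monomial-∤ f b t 0<t m t∤m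
    ... | yes (divides i refl) = begin
      coeff F (i * t)             ≡⟨ formula i ⟩
      coeff f i ℚ.* b ^ℚ i        ≡⟨ cong (ℚ._* b ^ℚ i) (proj₂ (Pure.degree f-pure) i (*-cancelʳ-< t d i dt<m)) ⟩
      0ℚ ℚ.* b ^ℚ i               ≡⟨ ℚP.*-zeroˡ (b ^ℚ i) ⟩
      0ℚ                          ∎
      where open ≡-Reasoning

    middle : ∀ i → 0 < i → i < d * t → ScaledVal≥ (d * t) (r * (d * t ∸ i)) (coeff F i)
    middle i _ _ with t ∣? i
    ... | no  t∤i = subst (ScaledVal≥ (d * t) _) (sym (coeff-∘monomial-∤ f b t 0<t i t∤i)) (ScaledVal≥-0 (*-mono-≤ 0<d 0<t))
    ... | yes (divides j refl) =
      subst (ScaledVal≥ (d * t) _) (sym (formula j))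
        (ScaledVal≥-*-unit (ScaledVal≥-weaken (≤-reflexive weight≡) (ScaledVal≥-scale t (Pure-bounds 0<d f-pure j)))
                           (Val≡-^ℚ b-unit j))
      where
      weight≡ : r * (d * t ∸ j * t) ≡ r * (d ∸ j) * t
      weight≡ = trans (cong (r *_) (sym (*-distribʳ-∸ t d j))) (sym (*-assoc r (d ∸ j) t))

  monomial∘-bounds : ∀ {r d f b} e B → 0 < d → 0 < e → Pure r d f → ScaledVal≥ (d * e) B b →
                     ∀ t i → ScaledVal≥ (d * e) (B + r * (d * t ∸ i) * e) (coeff (monomial b t ∘ₚ f) i)
  monomial∘-bounds {r} {d} {f} {b} e B 0<d 0<e f-pure b-bound =
    holds-monomial∘ (scaledVal (d * e) (*-mono-≤ 0<d 0<e)) f b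
      {U = λ i → r * (d ∸ i) * e} {W = λ t i → B + r * (d * t ∸ i) * e}
      W≤U+W b-bound₀ (λ i → ScaledVal≥-scale e (Pure-bounds 0<d f-pure i))
    where
    open ℕSolver.+-*-Solver
    W≤U+W : ∀ t i j → B + r * (d * suc t ∸ (i + j)) * e ≤ r * (d ∸ i) * e + (B + r * (d * t ∸ j) * e)
    W≤U+W t i j rewrite *-suc d t = begin
      B + r * ((d + d * t) ∸ (i + j)) * e
        ≤⟨ +-monoʳ-≤ B (*-monoˡ-≤ e (*-monoʳ-≤ r ([m+n]∸[o+q]≤[m∸o]+[n∸q] d (d * t) i j))) ⟩
      B + r * ((d ∸ i) + (d * t ∸ j)) * e
        ≡⟨ solve 5 (λ B r x y e → B :+ r :* (x :+ y) :* e := r :* x :* e :+ (B :+ r :* y :* e))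
                 refl B r (d ∸ i) (d * t ∸ j) e ⟩
      r * (d ∸ i) * e + (B + r * (d * t ∸ j) * e)
        ∎
      where open ≤-Reasoning
    b-bound₀ : ScaledVal≥ (d * e) (B + r * (d * 0 ∸ 0) * e) b
    b-bound₀ rewrite *-zeroʳ d | *-zeroʳ r | +-identityʳ B = b-bound

  Pure-monomial∘ : ∀ {r d f b} t → 0 < t → 0 < d → Val≡ 0 b → Pure r d f →
                   Σ ℚ λ c → Pure r (d * t) ((monomial b t ∘ₚ f) ⊕ const c)
  Pure-monomial∘ {r} {d} {f} {b} t 0<t 0<d b-unit f-pure =
    Pure-⊕const (*-mono-≤ 0<d 0<t) (Val≡⇒≢0 leading , Deg≤-monomial∘ f d b f≤d t) leading middle
    where
    G = monomial b t ∘ₚ f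
    f≤d = proj₂ (Pure.degree f-pure)

    leading : Val≡ 0 (coeff G (d * t))
    leading = subst (Val≡ 0) (sym (coeff-monomial∘-top f d b f≤d t))
                (Val≡-* (Val≡-^ℚ (Pure.leading f-pure) t) b-unit)

    middle : ∀ i → 0 < i → i < d * t → ScaledVal≥ (d * t) (r * (d * t ∸ i)) (coeff G i)
    middle i _ _ =
      ScaledVal≥-mono (*-monoʳ-≤ d 0<t)
        (ScaledVal≥-weaken (≤-reflexive (sym (*-identityʳ _)))
          (monomial∘-bounds 1 0 0<d (s≤s z≤n) f-pure (sv≥ 0 z≤n (Val≡⇒Val≥ b-unit)) t i))

  Pure-x^de+monomial∘ : ∀ {r d f b} t e → t < e → 0 < d → b ≢ 0ℚ →
                        + r ℤ.* + (e ∸ t) ℤ.≤ + e ℤ.* ν p b → Pure r d f →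
                        Σ ℚ λ c → Pure r (d * e) ((monomial 1ℚ (d * e) ⊕ (monomial b t ∘ₚ f)) ⊕ const c)
  Pure-x^de+monomial∘ {r} {d} {f} {b} t e t<e 0<d b≢0 b-bound f-pure =
    Pure-⊕const 0<de (Val≡⇒≢0 leading , beyond) leading middle
    where
    0<e : 0 < e
    0<e = ≤-<-trans z≤n t<e
    0<de : 0 < d * e
    0<de = *-mono-≤ 0<d 0<e
    dt<de : d * t < d * e
    dt<de = *-monoʳ-< d {{ℕ.>-nonZero 0<d}} t<e
    G = monomial b t ∘ₚ f
    H = monomial 1ℚ (d * e) ⊕ G
    G≤dt : Deg≤ G (d * t)
    G≤dt = Deg≤-monomial∘ f d b (proj₂ (Pure.degree f-pure)) t

    H≡G : ∀ i → i ≢ d * e → coeff H i ≡ coeff G i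
    H≡G i i≢de = begin
      coeff H i                                  ≡⟨ coeff-⊕ (monomial 1ℚ (d * e)) G i ⟩
      coeff (monomial 1ℚ (d * e)) i ℚ.+ coeff G i ≡⟨ cong (ℚ._+ coeff G i) (coeff-monomial-≢ 1ℚ (d * e) i i≢de) ⟩
      0ℚ ℚ.+ coeff G i                           ≡⟨ ℚP.+-identityˡ (coeff G i) ⟩
      coeff G i                                  ∎
      where open ≡-Reasoning

    leading : Val≡ 0 (coeff H (d * e))
    leading = subst (Val≡ 0) (sym H-top≡1) Val≡-1
      where
      H-top≡1 : coeff H (d * e) ≡ 1ℚ
      H-top≡1 = trans (coeff-⊕ (monomial 1ℚ (d * e)) G (d * e))
                  (trans (cong₂ ℚ._+_ (coeff-monomial-≡ 1ℚ (d * e)) (G≤dt (d * e) dt<de)) (ℚP.+-identityʳ 1ℚ))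

    beyond : ∀ m → d * e < m → coeff H m ≡ 0ℚ
    beyond m de<m = trans (H≡G m (>⇒≢ de<m)) (G≤dt m (<-trans dt<de de<m))

    b-bound′ : ScaledVal≥ (d * e) (r * (e ∸ t) * d) b
    b-bound′ = subst (λ s → ScaledVal≥ s (r * (e ∸ t) * d) b) (*-comm e d)
                 (ScaledVal≥-scale d (≤ν⇒ScaledVal≥ 0<e b≢0 (subst (ℤ._≤ _) (sym (ℤP.pos-* r (e ∸ t))) b-bound)))

    middle : ∀ i → 0 < i → i < d * e → ScaledVal≥ (d * e) (r * (d * e ∸ i)) (coeff H i)
    middle i _ i<de with i ≤? d * t
    ... | no  i≰dt = subst (ScaledVal≥ (d * e) _) (sym (trans (H≡G i (<⇒≢ i<de)) (G≤dt i (≰⇒> i≰dt))))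
                       (ScaledVal≥-0 0<de)
    ... | yes i≤dt = subst (ScaledVal≥ (d * e) _) (sym (H≡G i (<⇒≢ i<de)))
                       (ScaledVal≥-weaken (r[de∸i]≤r[e∸t]d+r[dt∸i]e r i≤dt (<⇒≤ t<e) 0<e)
                         (monomial∘-bounds e (r * (e ∸ t) * d) 0<d 0<e f-pure b-bound′ t i))

lemma3p9 : (p r d t : ℕ) (f : Poly) (b : ℚ) →
    Prime p → 1 ≤ r → HasDegree f d → 1 < d → PurePow p r f →
    1 ≤ t → ¬ (b ≡ 0ℚ) →
    (ν p b ≡ + 0 →
       PurePow p r (f ∘ₚ monomial b t) ×
       Σ ℚ (λ c → PurePow p r ((monomial b t ∘ₚ f) ⊕ const c)))
    ×
    ((e : ℕ) → t < e → (+ r ℤ.* + (e ∸ t)) ℤ.≤ (+ e ℤ.* ν p b) →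
       Σ ℚ (λ c → PurePow p r ((monomial 1ℚ (d * e) ⊕ (monomial b t ∘ₚ f)) ⊕ const c)))
lemma3p9 0 _ _ _ _ _ p-prime with () ← prime⇒nonTrivial p-prime
lemma3p9 1 _ _ _ _ _ p-prime with () ← prime⇒nonTrivial p-prime
lemma3p9 (suc (suc p-2)) r d t f b p-prime _ f-deg 1<d f-pure 0<t b≢0 =
  (λ νb≡0 → let b-unit = ν≡⇒Val≡ b≢0 νb≡0 in
     Pure⇒PurePow (Pure-∘monomial t 0<t 0<d b-unit f-pure′) ,
     map₂ Pure⇒PurePow (Pure-monomial∘ t 0<t 0<d b-unit f-pure′)) ,
  (λ e t<e b-bound → map₂ Pure⇒PurePow (Pure-x^de+monomial∘ t e t<e 0<d b≢0 b-bound f-pure′))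
  where
  open Valuation p-2 p-prime
  open Purity p-2 p-prime
  0<d : 0 < d
  0<d = <-trans (s≤s z≤n) 1<d
  f-pure′ : Pure r d f
  f-pure′ = PurePow⇒Pure 0<d f-deg f-pure
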